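{- Let $(G,\alpha)$ be an edge-labeled graph (simple or multigraph) over a commutative ring $R$ with unity. If $(G,\alpha)$ does not satisfy the Universal Difference Property, then no subdivision of $(G,\alpha)$ satisfies the Universal Difference Property.
   Context: An edge-labeling assigns to each edge (parallel edges allowed) an ideal of $R$. A spline on $(G,\alpha)$ is a function $\rho:V(G)\to R$ such that for every edge $e$ with endpoints $u,v$, $\rho(u)-\rho(v)\in\alpha(e)$. A path from $u$ to $v$ is a sequence of edges joining distinct consecutive vertices with no repeated vertices; $\alpha(P)$ is the sum of the ideals labeling the edges of $P$. $(G,\alpha)$ satisfies the Universal Difference Property (UDP) if for every pair of vertices $u,w$ and every $x$ in the intersection of $\alpha(P)$ over all paths $P$ from $u$ to $w$, there exists a spline $\rho$ with $\rho(u)-\rho(w)=x$. A subdivision of $G$ is obtained by successively replacing an edge $uv$ by a path $u,w,v$ through a new vertex $w$. A subdivision $(G',\alpha')$ of $(G,\alpha)$ has $G'$ a subdivision of $G$, with unsubdivided edges keeping their labels and every edge created by subdividing an edge $e$ labeled $\alpha(e)$. -}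

module Defs where

open import Level using (Level; _⊔_) renaming (suc to lsuc)
open import Algebra.Bundles using (CommutativeRing)
open import Data.Nat using (ℕ; suc)
open import Data.Fin using (Fin; zero; suc; _≟_)
open import Data.List using (List; []; _∷_)
open import Data.List.Relation.Unary.Unique.Propositional using (Unique)
open import Data.Product using (Σ; _×_; _,_; ∃)
open import Data.Sum using (_⊎_)
open import Relation.Binary.PropositionalEquality using (_≡_; _≢_)
open import Relation.Nullary using (yes; no)

module _ {c ℓ : Level} (R : CommutativeRing c ℓ) where
  open CommutativeRing R hiding (zero)

  record Ideal (ℓi : Level) : Set (c ⊔ ℓ ⊔ lsuc ℓi) where
    field
      _∈I   : Carrier → Set ℓi
      ∈-resp : ∀ {x y} → x ≈ y → x ∈I → y ∈I
      0∈     : 0# ∈I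
      +-closed : ∀ {x y} → x ∈I → y ∈I → (x + y) ∈I
      neg-closed : ∀ {x} → x ∈I → (- x) ∈I
      *-closed : ∀ r {x} → x ∈I → (r * x) ∈I
  open Ideal public

  _∈Σ_ : ∀ {ℓi} → Carrier → List (Ideal ℓi) → Set (c ⊔ ℓ ⊔ ℓi)
  _∈Σ_ {ℓi} x [] = Level.Lift (c ⊔ ℓi) (x ≈ 0#)
  _∈Σ_ {ℓi} x (I ∷ Is) =
    Σ Carrier λ a → Σ Carrier λ b → (I ∈I) a × (b ∈Σ Is) × (x ≈ a + b)

-- Finite multigraphs: vertices Fin nV, edges Fin nE, each edge e has
-- endpoints src e and tgt e (orientation is irrelevant; parallel edges allowed).

record Graph : Set where
  field
    nV : ℕ
    nE : ℕ
    src : Fin nE → Fin nV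
    tgt : Fin nE → Fin nV
open Graph public

Vert : Graph → Set
Vert G = Fin (nV G)

Edge : Graph → Set
Edge G = Fin (nE G)

Loopless : Graph → Set
Loopless G = ∀ e → src G e ≢ tgt G e

Joins : (G : Graph) → Edge G → Vert G → Vert G → Set
Joins G e u w = (src G e ≡ u × tgt G e ≡ w) ⊎ (src G e ≡ w × tgt G e ≡ u)

data Walk (G : Graph) : Vert G → Vert G → Set where
  []  : ∀ {u} → Walk G u u
  step : ∀ {u w v} (e : Edge G) → Joins G e u w → Walk G w v → Walk G u v

walkVertices : ∀ {G u v} → Walk G u v → List (Vert G)
walkVertices {u = u} [] = u ∷ []
walkVertices {u = u} (step e _ p) = u ∷ walkVertices p

walkEdges : ∀ {G u v} → Walk G u v → List (Edge G)
walkEdges [] = []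
walkEdges (step e _ p) = e ∷ walkEdges p

Path : (G : Graph) → Vert G → Vert G → Set
Path G u v = Σ (Walk G u v) λ p → Unique (walkVertices p)

module _ {c ℓ : Level} (R : CommutativeRing c ℓ) where
  open CommutativeRing R hiding (zero)

  record LGraph (ℓi : Level) : Set (c ⊔ ℓ ⊔ lsuc ℓi) where
    field
      graph : Graph
      label : Edge graph → Ideal R ℓi
  open LGraph public

  mapL : ∀ {a b} {A : Set a} {B : Set b} → (A → B) → List A → List B
  mapL f [] = []
  mapL f (x ∷ xs) = f x ∷ mapL f xs

  pathIdeals : ∀ {ℓi} (L : LGraph ℓi) {u v} → Path (graph L) u v → List (Ideal R ℓi)
  pathIdeals L (p , _) = mapL (label L) (walkEdges p)

  IsSpline : ∀ {ℓi} (L : LGraph ℓi) → (Vert (graph L) → Carrier) → Set ℓi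
  IsSpline L ρ = ∀ e → (label L e ∈I) (ρ (src (graph L) e) - ρ (tgt (graph L) e))

  UDP : ∀ {ℓi} → LGraph ℓi → Set (c ⊔ ℓ ⊔ ℓi)
  UDP L = ∀ (u w : Vert (graph L)) (x : Carrier) →
          (∀ (P : Path (graph L) u w) → _∈Σ_ R x (pathIdeals L P)) →
          Σ (Vert (graph L) → Carrier) λ ρ → IsSpline L ρ × (ρ u - ρ w) ≈ x

  -- subdividing edge e: a new vertex (zero) and a new edge (zero) are added;
  -- old vertices/edges are shifted by suc. Edge e now runs src e — new vertex,
  -- and the new edge runs new vertex — tgt e; both carry the label α(e).
  subdivideG : (G : Graph) → Edge G → Graph
  subdivideG G e = record
    { nV = suc (nV G) ; nE = suc (nE G) ; src = s ; tgt = t }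
    where
      s : Fin (suc (nE G)) → Fin (suc (nV G))
      s zero = zero
      s (suc e′) = suc (src G e′)
      t : Fin (suc (nE G)) → Fin (suc (nV G))
      t zero = suc (tgt G e)
      t (suc e′) with e′ ≟ e
      ... | yes _ = zero
      ... | no _ = suc (tgt G e′)

  subdivide : ∀ {ℓi} (L : LGraph ℓi) → Edge (graph L) → LGraph ℓi
  subdivide L e = record { graph = subdivideG (graph L) e ; label = lab }
    where
      lab : Fin (suc (nE (graph L))) → Ideal R _
      lab zero = label L e
      lab (suc e′) = label L e′

  data Subdivision {ℓi} (L : LGraph ℓi) : LGraph ℓi → Set (c ⊔ ℓ ⊔ lsuc ℓi) where
    done : Subdivision L L
    more : ∀ {L′} → Subdivision L L′ → (e : Edge (graph L′)) → Subdivision L (subdivide L′ e)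

{-# OPTIONS --safe #-}
-- A path of the subdivision between two old vertices either avoids the new
-- midpoint m of the subdivided edge e = st, or crosses m along both halves
-- sm and mt. Contracting the halves yields a path of the original graph whose
-- label ideals form a sublist of the longer path's (both halves are labeled
-- α(e)), so the hypothesis of UDP for two old vertices transfers from G to the
-- subdivision. Conversely a spline ρ on the subdivision restricts to one on G,
-- since ρ(s) − ρ(t) = (ρ(s) − ρ(m)) + (ρ(m) − ρ(t)) ∈ α(e). Hence UDP passes
-- from any single subdivision back to G, and the theorem follows by induction.
module Submission where

open import Defs
open import Level using (Level; _⊔_) renaming (suc to lsuc)
open import Algebra.Bundles using (CommutativeRing)
open import Relation.Nullary using (¬_; yes; no)

open import Data.Empty using (⊥-elim)
open import Data.Fin using (zero; suc; _≟_)
open import Data.List using (List; []; _∷_; map)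
open import Data.List.Membership.Propositional using (_∈_)
open import Data.List.Relation.Unary.Any using (here)
open import Data.List.Relation.Unary.All using (_∷_; lookup)
open import Data.List.Relation.Unary.AllPairs using ([]; _∷_)
open import Data.List.Relation.Unary.Unique.Propositional using (Unique)
open import Data.List.Relation.Unary.Unique.Propositional.Properties using (map⁻)
open import Data.List.Relation.Binary.Sublist.Propositional using (_⊆_; []; _∷_; _∷ʳ_)
open import Data.List.Relation.Binary.Sublist.Propositional.Properties using (All-resp-⊆)
open import Data.Product using (Σ; _,_)
open import Data.Sum using (inj₁; inj₂)
open import Function using (_∘_)
open import Relation.Binary.PropositionalEquality using (_≢_; refl)
import Relation.Binary.Reasoning.Setoid as ≈-Reasoning

Unique-resp-⊇ : ∀ {a} {A : Set a} {xs ys : List A} → xs ⊆ ys → Unique ys → Unique xs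
Unique-resp-⊇ []         []         = []
Unique-resp-⊇ (_ ∷ʳ s)   (_ ∷ ys!)  = Unique-resp-⊇ s ys!
Unique-resp-⊇ (refl ∷ s) (y∉ ∷ ys!) = All-resp-⊆ s y∉ ∷ Unique-resp-⊇ s ys!

head∈walkVertices : ∀ {G u v} (p : Walk G u v) → u ∈ walkVertices p
head∈walkVertices []           = here refl
head∈walkVertices (step _ _ _) = here refl

module _ {c ℓ} (R : CommutativeRing c ℓ) where
  open CommutativeRing R hiding (zero)

  ∈Σ-mono-⊆ : ∀ {ℓi} {Is Js : List (Ideal R ℓi)} → Is ⊆ Js →
              ∀ {x} → _∈Σ_ R x Is → _∈Σ_ R x Js
  ∈Σ-mono-⊆ []                       x∈ = x∈
  ∈Σ-mono-⊆ {Js = J ∷ _} (_ ∷ʳ s) {x} x∈ = 0# , x , 0∈ J , ∈Σ-mono-⊆ s x∈ , sym (+-identityˡ x)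
  ∈Σ-mono-⊆ (refl ∷ s) (a , b , a∈I , b∈Σ , x≈a+b) = a , b , a∈I , ∈Σ-mono-⊆ s b∈Σ , x≈a+b

  x-y+y-z≈x-z : ∀ x y z → (x - y) + (y - z) ≈ x - z
  x-y+y-z≈x-z x y z = begin
    (x - y) + (y - z)   ≈⟨ +-assoc x (- y) (y - z) ⟩
    x + (- y + (y - z)) ≈⟨ +-congˡ (sym (+-assoc (- y) y (- z))) ⟩
    x + ((- y + y) - z) ≈⟨ +-congˡ (+-congʳ (-‿inverseˡ y)) ⟩
    x + (0# - z)        ≈⟨ +-congˡ (+-identityˡ (- z)) ⟩
    x - z               ∎
    where open ≈-Reasoning setoid

module Subdivided {c ℓ ℓi} (R : CommutativeRing c ℓ) (L : LGraph R ℓi) (e : Edge (graph L)) where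
  open Ideal

  G G′ : Graph
  G  = graph L
  G′ = subdivideG R G e

  L′ : LGraph R ℓi
  L′ = subdivide R L e

  -- The vertex zero of G′ is the midpoint of e.
  data Joins′ : Edge G′ → Vert G′ → Vert G′ → Set where
    old     : ∀ {f u w} → f ≢ e → Joins G f u w → Joins′ (suc f) (suc u) (suc w)
    src→mid : Joins′ (suc e) (suc (src G e)) zero
    mid→src : Joins′ (suc e) zero (suc (src G e))
    mid→tgt : Joins′ zero zero (suc (tgt G e))
    tgt→mid : Joins′ zero (suc (tgt G e)) zero

  classify : ∀ {e′ v w} → Joins G′ e′ v w → Joins′ e′ v w
  classify {zero}  (inj₁ (refl , refl)) = mid→tgt
  classify {zero}  (inj₂ (refl , refl)) = tgt→mid
  classify {suc f} j with f ≟ e | j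
  ... | yes refl | inj₁ (refl , refl) = src→mid
  ... | yes refl | inj₂ (refl , refl) = mid→src
  ... | no f≢e   | inj₁ (refl , refl) = old f≢e (inj₁ (refl , refl))
  ... | no f≢e   | inj₂ (refl , refl) = old f≢e (inj₂ (refl , refl))

  record Projection {a b} (p : Walk G′ (suc a) (suc b)) : Set (c ⊔ ℓ ⊔ lsuc ℓi) where
    constructor projection
    field
      walk      : Walk G a b
      vertices⊆ : map suc (walkVertices walk) ⊆ walkVertices p
      ideals⊆   : mapL R (label L) (walkEdges walk) ⊆ mapL R (label L′) (walkEdges p)

  project : ∀ {a b} (p : Walk G′ (suc a) (suc b)) → Unique (walkVertices p) → Projection p
  project [] _ = projection [] (refl ∷ []) []
  project (step _ j rest) (_ ∷ rest!) with classify j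
  ... | old _ jf with project rest rest!
  ...   | projection q vs Is = projection (step _ jf q) (refl ∷ vs) (refl ∷ Is)
  project (step _ _ (step _ j rest)) (_ ∷ _ ∷ rest!) | src→mid with classify j
  ...   | mid→tgt with project rest rest!
  ...     | projection q vs Is =
          projection (step e (inj₁ (refl , refl)) q) (refl ∷ (_ ∷ʳ vs)) (refl ∷ (_ ∷ʳ Is))
  -- Leaving the midpoint through the edge just used revisits a vertex.
  project (step _ _ (step _ _ rest)) ((_ ∷ src∉) ∷ _) | src→mid | mid→src =
    ⊥-elim (lookup src∉ (head∈walkVertices rest) refl)
  project (step _ _ (step _ j rest)) (_ ∷ _ ∷ rest!) | tgt→mid with classify j
  ...   | mid→src with project rest rest!
  ...     | projection q vs Is =
          projection (step e (inj₂ (refl , refl)) q) (refl ∷ (_ ∷ʳ vs)) (refl ∷ (_ ∷ʳ Is))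
  project (step _ _ (step _ _ rest)) ((_ ∷ tgt∉) ∷ _) | tgt→mid | mid→tgt =
    ⊥-elim (lookup tgt∉ (head∈walkVertices rest) refl)

  projectPath : ∀ {a b} (P : Path G′ (suc a) (suc b)) →
                Σ (Path G a b) λ Q → pathIdeals R L Q ⊆ pathIdeals R L′ P
  projectPath (p , p!) = (walk , map⁻ (Unique-resp-⊇ vertices⊆ p!)) , ideals⊆
    where open Projection (project p p!)

  restrict-isSpline : ∀ ρ → IsSpline R L′ ρ → IsSpline R L (ρ ∘ suc)
  restrict-isSpline ρ ρ-spline f with f ≟ e | ρ-spline (suc f)
  ... | yes refl | src-mid = ∈-resp (label L e) (x-y+y-z≈x-z R _ _ _)
                                    (+-closed (label L e) src-mid (ρ-spline zero))
  ... | no _     | src-tgt = src-tgt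

  UDP-subdivide⇒UDP : UDP R L′ → UDP R L
  UDP-subdivide⇒UDP udp u w x x∈paths =
    let ρ , ρ-spline , ρu-ρw≈x = udp (suc u) (suc w) x x∈paths′
    in ρ ∘ suc , restrict-isSpline ρ ρ-spline , ρu-ρw≈x
    where
    x∈paths′ : ∀ P → _∈Σ_ R x (pathIdeals R L′ P)
    x∈paths′ P = let Q , Q⊆P = projectPath P in ∈Σ-mono-⊆ R Q⊆P (x∈paths Q)

theorem3p7 : ∀ {c ℓ ℓi : Level} (R : CommutativeRing c ℓ) (L : LGraph R ℓi) →
    Loopless (graph L) → ¬ UDP R L →
    ∀ (L′ : LGraph R ℓi) → Subdivision R L L′ → ¬ UDP R L′
theorem3p7 R L _ ¬udp .L done = ¬udp
theorem3p7 R L loopless ¬udp _ (more s e) =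
  theorem3p7 R L loopless ¬udp _ s ∘ Subdivided.UDP-subdivide⇒UDP R _ e
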